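{- Let $\lambda,\mu$ be partitions with at most $n$ parts, $f=(f_1,\dots,f_n)$ and $g=(g_1,\dots,g_n)$ sequences of positive integers, and $1\le i,j\le n$. Then \[ \sum_{s\ge0}\binom{i-j}{s}\beta^sG^{[f_i/g_j]}_{\lambda_i-\mu_j-i+j+s}(x)=C_{i,j}\,h_{\lambda_i-\mu_j-i+j}\big[X_{[g_j,f_i]}\ominus(j-i+1)\overline\beta\big], \] where $C_{i,j}=\prod_{l=g_j}^{f_i}(1+\beta x_l)$ (empty product $=1$).
   Context: $\beta$ is a parameter, $x=(x_1,x_2,\dots)$ indeterminates; partitions are padded with zeros. For an integer $a$ and $s\ge0$, $\binom{a}{s}=a(a-1)\cdots(a-s+1)/s!$. For positive integers $p,q$, the series $G^{[p/q]}_m(x)$, $m\in\mathbb Z$, are defined by the Laurent series identity in $u$ \[ \sum_{m\in\mathbb Z}G^{[p/q]}_m(x)u^m=\frac{1}{1+\beta u^{ -1}}\prod_{q\le i\le p}\frac{1+\beta x_i}{1-x_iu}, \] with $\frac1{1+\beta u^{ -1}}=\sum_{k\ge0}(-\beta u^{ -1})^k$, $\frac{1+\beta x_i}{1-x_iu}=(1+\beta x_i)\sum_{l\ge0}x_i^lu^l$, and the product $1$ if $p<q$. $X_{[q,p]}=x_q+\dots+x_p$ ($=0$ if $q>p$). Here $\overline\beta=-\beta$ is treated as a single plethystic variable: for an integer $c$, $h_b[c\overline\beta]$ is the coefficient of $t^b$ in $(1-\overline\beta t)^{ -c}=(1+\beta t)^{ -c}$, and \[ h_m\big[X_{[q,p]}\ominus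 c\overline\beta\big]=\sum_{b\ge0}h_{m+b}(x_q,\dots,x_p)\,h_b[c\overline\beta], \] where $h_a$ is the complete homogeneous symmetric polynomial ($h_0=1$, $h_a=0$ for $a<0$, and $h_a$ of no variables is $\delta_{a,0}$). -}

module Defs where

open import Data.Bool using (Bool; true; false; _∧_; if_then_else_)
open import Data.Nat as ℕ using (ℕ; zero; suc; _∸_; _≤ᵇ_; _≡ᵇ_; _!)
open import Data.Nat.Properties using (_!≢0)
open import Data.Integer as ℤ using (ℤ; +_; -[1+_]; 0ℤ; 1ℤ; -1ℤ)
open import Data.Integer.DivMod using (_/ℕ_)
open import Data.List using (List; []; _∷_; map; foldr; upTo; concatMap)
open import Data.Product using (_×_; _,_)
open import Data.Vec using (Vec; lookup)
open import Data.Fin using (Fin; toℕ)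
open import Relation.Binary.PropositionalEquality using (_≡_)

Σℤ : List ℤ → ℤ
Σℤ = foldr ℤ._+_ 0ℤ

range0 : ℕ → List ℕ
range0 n = upTo (suc n)

rangeFromTo : ℕ → ℕ → List ℕ
rangeFromTo q p = if q ≤ᵇ p then map (q ℕ.+_) (upTo (suc (p ∸ q))) else []

δ : Bool → ℤ
δ b = if b then 1ℤ else 0ℤ

falling : ℤ → ℕ → ℤ
falling a zero = 1ℤ
falling a (suc s) = falling a s ℤ.* (a ℤ.- + s)

binomℤ : ℤ → ℕ → ℤ
binomℤ a s = (falling a s /ℕ (s !)) {{s !≢0}}

-- Monomials in x = (x₁, x₂, ...): a list of exponents, the k-th entry
-- (0-based) being the exponent of x_{k+1}; missing entries are 0.

Mono : Set
Mono = List ℕ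

allZero : Mono → Bool
allZero [] = true
allZero (e ∷ α) = (e ≡ᵇ 0) ∧ allZero α

isVar : ℕ → Mono → Bool
isVar zero α = false
isVar (suc l) [] = false
isVar (suc zero) (e ∷ α) = (e ≡ᵇ 1) ∧ allZero α
isVar (suc (suc l)) (e ∷ α) = (e ≡ᵇ 0) ∧ isVar (suc l) α

deg : Mono → ℕ
deg = foldr ℕ._+_ 0

-- every variable x_l occurring in α satisfies q ≤ l ≤ p;
-- the first entry of the list is the exponent of x_pos
supportIn' : ℕ → ℕ → ℕ → Mono → Bool
supportIn' q p pos [] = true
supportIn' q p pos (e ∷ α) =
  ((e ≡ᵇ 0) Data.Bool.∨ ((q ≤ᵇ pos) ∧ (pos ≤ᵇ p))) ∧ supportIn' q p (suc pos) α

supportIn : ℕ → ℕ → Mono → Bool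
supportIn q p = supportIn' q p 1

splitsℕ : ℕ → List (ℕ × ℕ)
splitsℕ n = map (λ k → k , n ∸ k) (range0 n)

splitsM : Mono → List (Mono × Mono)
splitsM [] = ([] , []) ∷ []
splitsM (e ∷ α) =
  concatMap (λ { (k , l) → map (λ { (α₁ , α₂) → (k ∷ α₁) , (l ∷ α₂) }) (splitsM α) })
            (splitsℕ e)

-- Formal power series in β and x with integer coefficients:
-- F a α = coefficient of β^a x^α.

PS : Set
PS = ℕ → Mono → ℤ

_≈ₚ_ : PS → PS → Set
F ≈ₚ G = ∀ a α → F a α ≡ G a α

0ₚ : PS
0ₚ a α = 0ℤ

1ₚ : PS
1ₚ a α = δ ((a ≡ᵇ 0) ∧ allZero α)

βₚ : PS
βₚ a α = δ ((a ≡ᵇ 1) ∧ allZero α)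

xₚ : ℕ → PS
xₚ l a α = δ ((a ≡ᵇ 0) ∧ isVar l α)

_+ₚ_ : PS → PS → PS
(F +ₚ G) a α = F a α ℤ.+ G a α

scale : ℤ → PS → PS
scale c F a α = c ℤ.* F a α

_*ₚ_ : PS → PS → PS
(F *ₚ G) a α =
  Σℤ (concatMap (λ { (a₁ , a₂) →
        map (λ { (α₁ , α₂) → F a₁ α₁ ℤ.* G a₂ α₂ }) (splitsM α) })
      (splitsℕ a))

infixl 6 _+ₚ_
infixl 7 _*ₚ_

powₚ : PS → ℕ → PS
powₚ F zero = 1ₚ
powₚ F (suc k) = F *ₚ powₚ F k

prodₚ : ℕ → ℕ → (ℕ → PS) → PS
prodₚ q p f = foldr (λ i acc → f i *ₚ acc) 1ₚ (rangeFromTo q p)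

-- Sum Σ_{k ≥ 0} F k of a family with F k ∈ β^k · PS (β-adically
-- convergent): only k ≤ a contributes to the coefficient of β^a.
sumβ : (ℕ → PS) → PS
sumβ F a α = Σℤ (map (λ k → F k a α) (range0 a))

hPoly : ℤ → ℕ → ℕ → PS
hPoly (+ d) q p a α = δ ((a ≡ᵇ 0) ∧ supportIn q p α ∧ (deg α ≡ᵇ d))
hPoly -[1+ d ] q p a α = 0ℤ

-- Power series in u with coefficients in PS:  B n = coefficient of u^n.

USer : Set
USer = ℕ → PS

1ᵤ : USer
1ᵤ zero = 1ₚ
1ᵤ (suc n) = 0ₚ

_*ᵤ_ : USer → USer → USer
(A *ᵤ B) n = foldr (λ k acc → A k *ₚ B (n ∸ k) +ₚ acc) 0ₚ (range0 n)

-- (1 + β x_i) / (1 - x_i u) = (1 + β x_i) Σ_l x_i^l u^l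
factorᵤ : ℕ → USer
factorᵤ i l = (1ₚ +ₚ βₚ *ₚ xₚ i) *ₚ powₚ (xₚ i) l

Bᵤ : ℕ → ℕ → USer
Bᵤ q p = foldr (λ i acc → factorᵤ i *ᵤ acc) 1ᵤ (rangeFromTo q p)

coefU : USer → ℤ → PS
coefU B (+ n) = B n
coefU B -[1+ n ] = 0ₚ

-- G^{[p/q]}_m : coefficient of u^m in
--   (Σ_{k≥0} (-β u^{-1})^k) · Π_{q≤i≤p} (1+βx_i)/(1-x_i u)
-- = Σ_{k≥0} (-β)^k [u^{m+k}] Π_{q≤i≤p} (1+βx_i)/(1-x_i u).
G : ℕ → ℕ → ℤ → PS
G p q m = sumβ (λ k → powₚ (scale -1ℤ βₚ) k *ₚ coefU (Bᵤ q p) (m ℤ.+ + k))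

-- h_b[c β̄] = coefficient of t^b in (1 - β̄ t)^{-c} = (1 + β t)^{-c}.
-- Power series in y = β t with integer coefficients; the coefficient of
-- t^b in a series Σ c_b y^b is c_b β^b.

YSer : Set
YSer = ℕ → ℤ

1ʸ : YSer
1ʸ zero = 1ℤ
1ʸ (suc n) = 0ℤ

_*ʸ_ : YSer → YSer → YSer
(A *ʸ B) n = Σℤ (map (λ k → A k ℤ.* B (n ∸ k)) (range0 n))

powʸ : YSer → ℕ → YSer
powʸ A zero = 1ʸ
powʸ A (suc k) = A *ʸ powʸ A k

onePlusY : YSer
onePlusY zero = 1ℤ
onePlusY (suc zero) = 1ℤ
onePlusY (suc (suc n)) = 0ℤ

invOnePlusY : YSer
invOnePlusY zero = 1ℤ
invOnePlusY (suc k) = -1ℤ ℤ.* invOnePlusY k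

onePlusYNeg : ℤ → YSer
onePlusYNeg (+ n) = powʸ invOnePlusY n
onePlusYNeg -[1+ n ] = powʸ onePlusY (suc n)

hBeta : ℤ → ℕ → PS
hBeta c b = scale (onePlusYNeg c b) (powₚ βₚ b)

-- h_m[X_{[q,p]} ⊖ c β̄] = Σ_{b≥0} h_{m+b}(x_q,...,x_p) h_b[c β̄]
hPleth : ℤ → ℕ → ℕ → ℤ → PS
hPleth m q p c = sumβ (λ b → hPoly (m ℤ.+ + b) q p *ₚ hBeta c b)

Cfac : ℕ → ℕ → PS
Cfac f g = prodₚ g f (λ l → 1ₚ +ₚ βₚ *ₚ xₚ l)

-- Partitions with at most n parts (padded with zeros): weakly decreasing
-- vectors of naturals of length n.

IsPartition : {n : ℕ} → Vec ℕ n → Set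
IsPartition {n} v = (k l : Fin n) → toℕ k ℕ.≤ toℕ l → lookup v l ℕ.≤ lookup v k

{-# OPTIONS --safe #-}
-- Since Π_{q≤l≤p} 1/(1 - x_l u) = Σ_r h_r(x_q,…,x_p) u^r, the coefficient of u^r in the product
-- defining G is C h_r, so G^{[p/q]}_m = C Σ_k (-β)^k h_{m+k}(x_q,…,x_p).  Collecting powers of β,
-- the left-hand side becomes C Σ_N β^N h_{M+N} Σ_{s+k=N} binom(i-j,s) (-1)^k, and the inner sum
-- is the coefficient of y^N in (1+y)^{i-j} (1+y)^{-1} = (1+y)^{-(j-i+1)}, which is exactly the
-- coefficient defining h_N[(j-i+1)β̄].

module Submission where

open import Defs
open import Data.Nat using (ℕ; suc; _≤_)
open import Data.Integer using (ℤ; +_; _+_; _-_)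
open import Data.Fin using (Fin; toℕ)
open import Data.Vec using (Vec; lookup)

open import Algebra.Bundles using (CommutativeMonoid; CommutativeSemigroup)
open import Algebra.Properties.CommutativeSemigroup using (interchange; x∙yz≈y∙xz)
open import Data.Bool using (Bool; true; false; _∧_; _∨_; if_then_else_)
import Data.Bool.Properties as Boolₚ
open import Data.Empty using (⊥-elim)
open import Data.Integer as ℤ using (-[1+_]; 0ℤ; 1ℤ; -1ℤ; _*_; -_; _^_)
open import Data.Integer.DivMod using (_/ℕ_)
import Data.Integer.Properties as ℤₚ
open import Data.Integer.Tactic.RingSolver using (solve-∀)
open import Data.List using (List; []; _∷_; map; foldr; upTo; concatMap; applyUpTo; _++_)
import Data.List.Properties as Listₚ
open import Data.Nat as ℕ using (zero; _∸_; _<_; z≤n; s≤s; _≤ᵇ_; _≡ᵇ_; _!)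
open import Data.Nat.DivMod using (m*n/n≡m; m*n%n≡0)
import Data.Nat.Properties as ℕₚ
open import Data.Product using (_×_; _,_; proj₁; proj₂)
open import Function using (_∘_; Equivalence)
open import Level using (0ℓ)
open import Relation.Binary.PropositionalEquality
  using (_≡_; _≢_; refl; sym; trans; cong; cong₂; subst; module ≡-Reasoning)
open import Relation.Binary.Structures using (IsEquivalence)
open import Relation.Nullary using (yes; no)

∑≤ : ℕ → (ℕ → ℤ) → ℤ
∑≤ zero f = f 0
∑≤ (suc n) f = f 0 + ∑≤ n (f ∘ suc)

infix 5 ∑≤
syntax ∑≤ n (λ k → e) = ∑[ k ≤ n ] e

Σℤ-applyUpTo : ∀ n (f : ℕ → ℤ) → Σℤ (applyUpTo f (suc n)) ≡ ∑≤ n f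
Σℤ-applyUpTo zero f = ℤₚ.+-identityʳ (f 0)
Σℤ-applyUpTo (suc n) f = cong (_+_ (f 0)) (Σℤ-applyUpTo n (f ∘ suc))

Σℤ-map-range0 : ∀ n (f : ℕ → ℤ) → Σℤ (map f (range0 n)) ≡ ∑≤ n f
Σℤ-map-range0 n f = trans (cong Σℤ (Listₚ.map-upTo f (suc n))) (Σℤ-applyUpTo n f)

∑≤-cong-≤ : ∀ n {f g : ℕ → ℤ} → (∀ k → k ≤ n → f k ≡ g k) → ∑≤ n f ≡ ∑≤ n g
∑≤-cong-≤ zero f≗g = f≗g 0 z≤n
∑≤-cong-≤ (suc n) f≗g = cong₂ _+_ (f≗g 0 z≤n) (∑≤-cong-≤ n (λ k k≤n → f≗g (suc k) (s≤s k≤n)))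

∑≤-cong : ∀ n {f g : ℕ → ℤ} → (∀ k → f k ≡ g k) → ∑≤ n f ≡ ∑≤ n g
∑≤-cong n f≗g = ∑≤-cong-≤ n (λ k _ → f≗g k)

∑≤-zero : ∀ n {f : ℕ → ℤ} → (∀ k → k ≤ n → f k ≡ 0ℤ) → ∑≤ n f ≡ 0ℤ
∑≤-zero zero f≗0 = f≗0 0 z≤n
∑≤-zero (suc n) f≗0 = cong₂ _+_ (f≗0 0 z≤n) (∑≤-zero n (λ k k≤n → f≗0 (suc k) (s≤s k≤n)))

∑≤-single : ∀ n s {f : ℕ → ℤ} → s ≤ n → (∀ k → k ≤ n → k ≢ s → f k ≡ 0ℤ) → ∑≤ n f ≡ f s
∑≤-single zero .zero z≤n _ = refl
∑≤-single (suc n) zero {f} _ f≗0 =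
  trans (cong (_+_ (f 0)) (∑≤-zero n (λ k k≤n → f≗0 (suc k) (s≤s k≤n) (λ ()))))
        (ℤₚ.+-identityʳ (f 0))
∑≤-single (suc n) (suc s) (s≤s s≤n) f≗0 =
  trans (cong₂ _+_ (f≗0 0 z≤n (λ ()))
                   (∑≤-single n s s≤n (λ k k≤n k≢s → f≗0 (suc k) (s≤s k≤n) (k≢s ∘ ℕₚ.suc-injective))))
        (ℤₚ.+-identityˡ _)

∑≤-sucʳ : ∀ n (f : ℕ → ℤ) → ∑≤ (suc n) f ≡ ∑≤ n f + f (suc n)
∑≤-sucʳ zero f = refl
∑≤-sucʳ (suc n) f = trans (cong (_+_ (f 0)) (∑≤-sucʳ n (f ∘ suc))) (sym (ℤₚ.+-assoc (f 0) _ _))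

∑≤-distrib-+ : ∀ n (f g : ℕ → ℤ) → ∑[ k ≤ n ] (f k + g k) ≡ ∑≤ n f + ∑≤ n g
∑≤-distrib-+ zero f g = refl
∑≤-distrib-+ (suc n) f g =
  trans (cong (_+_ (f 0 + g 0)) (∑≤-distrib-+ n (f ∘ suc) (g ∘ suc))) (shuffle (f 0) (g 0) _ _)
  where
  shuffle : ∀ a b c d → a + b + (c + d) ≡ a + c + (b + d)
  shuffle = solve-∀

*-distribˡ-∑≤ : ∀ n c (f : ℕ → ℤ) → c * ∑≤ n f ≡ ∑[ k ≤ n ] (c * f k)
*-distribˡ-∑≤ zero c f = refl
*-distribˡ-∑≤ (suc n) c f =
  trans (ℤₚ.*-distribˡ-+ c (f 0) _) (cong (_+_ (c * f 0)) (*-distribˡ-∑≤ n c (f ∘ suc)))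

*-distribʳ-∑≤ : ∀ n c (f : ℕ → ℤ) → ∑≤ n f * c ≡ ∑[ k ≤ n ] (f k * c)
*-distribʳ-∑≤ n c f =
  trans (ℤₚ.*-comm (∑≤ n f) c) (trans (*-distribˡ-∑≤ n c f) (∑≤-cong n (λ k → ℤₚ.*-comm c (f k))))

∑≤-comm : ∀ n m (f : ℕ → ℕ → ℤ) → ∑[ k ≤ n ] ∑≤ m (f k) ≡ ∑[ j ≤ m ] ∑[ k ≤ n ] f k j
∑≤-comm zero m f = refl
∑≤-comm (suc n) m f =
  trans (cong (_+_ (∑≤ m (f 0))) (∑≤-comm n m (f ∘ suc))) (sym (∑≤-distrib-+ m (f 0) _))

∑≤-triangle : ∀ a (f : ℕ → ℕ → ℕ → ℤ) →
  ∑[ k ≤ a ] ∑[ j ≤ k ] f j (k ∸ j) (a ∸ k) ≡ ∑[ j ≤ a ] ∑[ l ≤ a ∸ j ] f j l (a ∸ j ∸ l)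
∑≤-triangle zero f = refl
∑≤-triangle (suc a) f =
  begin
    f 0 0 (suc a) + (∑[ k ≤ a ] (f 0 (suc k) (a ∸ k) + (∑[ j ≤ k ] f (suc j) (k ∸ j) (a ∸ k))))
  ≡⟨ cong (_+_ (f 0 0 (suc a))) (∑≤-distrib-+ a _ _) ⟩
    f 0 0 (suc a) + ((∑[ k ≤ a ] f 0 (suc k) (a ∸ k)) + (∑[ k ≤ a ] ∑[ j ≤ k ] f (suc j) (k ∸ j) (a ∸ k)))
  ≡⟨ cong (λ z → f 0 0 (suc a) + ((∑[ k ≤ a ] f 0 (suc k) (a ∸ k)) + z)) (∑≤-triangle a (f ∘ suc)) ⟩
    f 0 0 (suc a) + ((∑[ k ≤ a ] f 0 (suc k) (a ∸ k)) + (∑[ j ≤ a ] ∑[ l ≤ a ∸ j ] f (suc j) l (a ∸ j ∸ l)))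
  ≡⟨ sym (ℤₚ.+-assoc (f 0 0 (suc a)) _ _) ⟩
    f 0 0 (suc a) + (∑[ k ≤ a ] f 0 (suc k) (a ∸ k)) + (∑[ j ≤ a ] ∑[ l ≤ a ∸ j ] f (suc j) l (a ∸ j ∸ l))
  ∎
  where open ≡-Reasoning

∑≤-reverse : ∀ a (f : ℕ → ℕ → ℤ) → ∑[ k ≤ a ] f k (a ∸ k) ≡ ∑[ k ≤ a ] f (a ∸ k) k
∑≤-reverse zero f = refl
∑≤-reverse (suc a) f =
  begin
    f 0 (suc a) + (∑[ k ≤ a ] f (suc k) (a ∸ k))
  ≡⟨ cong (_+_ (f 0 (suc a))) (∑≤-reverse a (f ∘ suc)) ⟩
    f 0 (suc a) + (∑[ k ≤ a ] f (suc (a ∸ k)) k)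
  ≡⟨ cong (_+_ (f 0 (suc a))) (∑≤-cong-≤ a (λ k k≤a → cong (λ z → f z k) (sym (ℕₚ.+-∸-assoc 1 k≤a)))) ⟩
    f 0 (suc a) + (∑[ k ≤ a ] f (suc a ∸ k) k)
  ≡⟨ ℤₚ.+-comm (f 0 (suc a)) _ ⟩
    (∑[ k ≤ a ] f (suc a ∸ k) k) + f 0 (suc a)
  ≡⟨ cong (λ z → (∑[ k ≤ a ] f (suc a ∸ k) k) + f z (suc a)) (sym (ℕₚ.n∸n≡0 a)) ⟩
    (∑[ k ≤ a ] f (suc a ∸ k) k) + f (suc a ∸ suc a) (suc a)
  ≡⟨ sym (∑≤-sucʳ a (λ k → f (suc a ∸ k) k)) ⟩
    ∑[ k ≤ suc a ] f (suc a ∸ k) k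
  ∎
  where open ≡-Reasoning

∑split : Mono → (Mono → Mono → ℤ) → ℤ
∑split [] φ = φ [] []
∑split (e ∷ α) φ = ∑[ k ≤ e ] ∑split α (λ x y → φ (k ∷ x) ((e ∸ k) ∷ y))

infix 5 ∑split
syntax ∑split α (λ x y → e) = ∑[ x · y ≔ α ] e

Σℤ-++ : ∀ (xs ys : List ℤ) → Σℤ (xs ++ ys) ≡ Σℤ xs + Σℤ ys
Σℤ-++ [] ys = sym (ℤₚ.+-identityˡ _)
Σℤ-++ (x ∷ xs) ys = trans (cong (_+_ x) (Σℤ-++ xs ys)) (sym (ℤₚ.+-assoc x _ _))

Σℤ-concatMap : ∀ {A : Set} (h : A → List ℤ) xs → Σℤ (concatMap h xs) ≡ Σℤ (map (Σℤ ∘ h) xs)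
Σℤ-concatMap h [] = refl
Σℤ-concatMap h (x ∷ xs) = trans (Σℤ-++ (h x) (concatMap h xs)) (cong (_+_ (Σℤ (h x))) (Σℤ-concatMap h xs))

Σℤ-map-splitsℕ : ∀ e (g : ℕ × ℕ → ℤ) → Σℤ (map g (splitsℕ e)) ≡ ∑[ k ≤ e ] g (k , e ∸ k)
Σℤ-map-splitsℕ e g =
  trans (cong Σℤ (sym (Listₚ.map-∘ {g = g} {f = λ k → k , e ∸ k} (range0 e)))) (Σℤ-map-range0 e _)

Σℤ-map-splitsM : ∀ α (g : Mono × Mono → ℤ) → Σℤ (map g (splitsM α)) ≡ ∑[ x · y ≔ α ] g (x , y)
Σℤ-map-splitsM [] g = ℤₚ.+-identityʳ _
Σℤ-map-splitsM (e ∷ α) g =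
  begin
    Σℤ (map g (concatMap consAll (splitsℕ e)))
  ≡⟨ cong Σℤ (Listₚ.map-concatMap g consAll (splitsℕ e)) ⟩
    Σℤ (concatMap (map g ∘ consAll) (splitsℕ e))
  ≡⟨ Σℤ-concatMap (map g ∘ consAll) (splitsℕ e) ⟩
    Σℤ (map (Σℤ ∘ map g ∘ consAll) (splitsℕ e))
  ≡⟨ Σℤ-map-splitsℕ e (Σℤ ∘ map g ∘ consAll) ⟩
    ∑[ k ≤ e ] Σℤ (map g (consAll (k , e ∸ k)))
  ≡⟨ ∑≤-cong e (λ k → cong Σℤ (sym (Listₚ.map-∘ (splitsM α)))) ⟩
    ∑[ k ≤ e ] Σℤ (map (λ q → g ((k ∷ proj₁ q) , ((e ∸ k) ∷ proj₂ q))) (splitsM α))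
  ≡⟨ ∑≤-cong e (λ k → Σℤ-map-splitsM α _) ⟩
    ∑[ k ≤ e ] ∑[ x · y ≔ α ] g ((k ∷ x) , ((e ∸ k) ∷ y))
  ∎
  where
  open ≡-Reasoning
  consAll : ℕ × ℕ → List (Mono × Mono)
  consAll (k , l) = map (λ q → (k ∷ proj₁ q) , (l ∷ proj₂ q)) (splitsM α)

*ₚ-coeff : ∀ F G a α → (F *ₚ G) a α ≡ ∑[ k ≤ a ] ∑[ x · y ≔ α ] F k x * G (a ∸ k) y
*ₚ-coeff F G a α =
  begin
    Σℤ (concatMap termsAt (splitsℕ a))
  ≡⟨ Σℤ-concatMap termsAt (splitsℕ a) ⟩
    Σℤ (map (Σℤ ∘ termsAt) (splitsℕ a))
  ≡⟨ Σℤ-map-splitsℕ a (Σℤ ∘ termsAt) ⟩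
    ∑[ k ≤ a ] Σℤ (termsAt (k , a ∸ k))
  ≡⟨ ∑≤-cong a (λ k → Σℤ-map-splitsM α _) ⟩
    ∑[ k ≤ a ] ∑[ x · y ≔ α ] F k x * G (a ∸ k) y
  ∎
  where
  open ≡-Reasoning
  termsAt : ℕ × ℕ → List ℤ
  termsAt (k , l) = map (λ q → F k (proj₁ q) * G l (proj₂ q)) (splitsM α)

∑split-cong : ∀ α {φ ψ : Mono → Mono → ℤ} → (∀ x y → φ x y ≡ ψ x y) → ∑split α φ ≡ ∑split α ψ
∑split-cong [] φ≗ψ = φ≗ψ [] []
∑split-cong (e ∷ α) φ≗ψ = ∑≤-cong e (λ k → ∑split-cong α (λ x y → φ≗ψ (k ∷ x) ((e ∸ k) ∷ y)))

∑split-zero : ∀ α {φ : Mono → Mono → ℤ} → (∀ x y → φ x y ≡ 0ℤ) → ∑split α φ ≡ 0ℤ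
∑split-zero [] φ≗0 = φ≗0 [] []
∑split-zero (e ∷ α) φ≗0 = ∑≤-zero e (λ k _ → ∑split-zero α (λ x y → φ≗0 _ _))

*-distribˡ-∑split : ∀ α c (φ : Mono → Mono → ℤ) → c * ∑split α φ ≡ ∑[ x · y ≔ α ] (c * φ x y)
*-distribˡ-∑split [] c φ = refl
*-distribˡ-∑split (e ∷ α) c φ =
  trans (*-distribˡ-∑≤ e c _) (∑≤-cong e (λ k → *-distribˡ-∑split α c _))

*-distribʳ-∑split : ∀ α c (φ : Mono → Mono → ℤ) → ∑split α φ * c ≡ ∑[ x · y ≔ α ] (φ x y * c)
*-distribʳ-∑split α c φ =
  trans (ℤₚ.*-comm (∑split α φ) c)
        (trans (*-distribˡ-∑split α c φ) (∑split-cong α (λ x y → ℤₚ.*-comm c (φ x y))))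

∑split-∑≤-comm : ∀ α n (ψ : ℕ → Mono → Mono → ℤ) →
  ∑[ x · y ≔ α ] ∑[ j ≤ n ] ψ j x y ≡ ∑[ j ≤ n ] ∑split α (ψ j)
∑split-∑≤-comm [] n ψ = refl
∑split-∑≤-comm (e ∷ α) n ψ =
  trans (∑≤-cong e (λ k → ∑split-∑≤-comm α n (λ j x y → ψ j (k ∷ x) ((e ∸ k) ∷ y))))
        (∑≤-comm e n (λ k j → ∑[ x · y ≔ α ] ψ j (k ∷ x) ((e ∸ k) ∷ y)))

∑split-swap : ∀ α (φ : Mono → Mono → ℤ) → ∑split α φ ≡ ∑[ x · y ≔ α ] φ y x
∑split-swap [] φ = refl
∑split-swap (e ∷ α) φ =
  trans (∑≤-cong e (λ k → ∑split-swap α (λ x y → φ (k ∷ x) ((e ∸ k) ∷ y))))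
        (∑≤-reverse e (λ k k′ → ∑[ x · y ≔ α ] φ (k ∷ y) (k′ ∷ x)))

∑split-assoc : ∀ α (f : Mono → Mono → Mono → ℤ) →
  ∑[ x · y ≔ α ] ∑[ u · v ≔ x ] f u v y ≡ ∑[ u · w ≔ α ] ∑[ v · y ≔ w ] f u v y
∑split-assoc [] f = refl
∑split-assoc (e ∷ α) f =
  begin
    ∑[ k ≤ e ] ∑[ x · y ≔ α ] ∑[ j ≤ k ] ∑[ u · v ≔ x ] f′ j (k ∸ j) (e ∸ k) u v y
  ≡⟨ ∑≤-cong e (λ k → ∑split-∑≤-comm α k _) ⟩
    ∑[ k ≤ e ] ∑[ j ≤ k ] ∑[ x · y ≔ α ] ∑[ u · v ≔ x ] f′ j (k ∸ j) (e ∸ k) u v y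
  ≡⟨ ∑≤-cong e (λ k → ∑≤-cong k (λ j → ∑split-assoc α (f′ j (k ∸ j) (e ∸ k)))) ⟩
    ∑[ k ≤ e ] ∑[ j ≤ k ] ∑[ u · w ≔ α ] ∑[ v · y ≔ w ] f′ j (k ∸ j) (e ∸ k) u v y
  ≡⟨ ∑≤-triangle e (λ j l m → ∑[ u · w ≔ α ] ∑[ v · y ≔ w ] f′ j l m u v y) ⟩
    ∑[ j ≤ e ] ∑[ l ≤ e ∸ j ] ∑[ u · w ≔ α ] ∑[ v · y ≔ w ] f′ j l (e ∸ j ∸ l) u v y
  ≡⟨ ∑≤-cong e (λ j → ∑split-∑≤-comm α (e ∸ j) _) ⟨
    ∑[ j ≤ e ] ∑[ u · w ≔ α ] ∑[ l ≤ e ∸ j ] ∑[ v · y ≔ w ] f′ j l (e ∸ j ∸ l) u v y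
  ∎
  where
  open ≡-Reasoning
  f′ : ℕ → ℕ → ℕ → Mono → Mono → Mono → ℤ
  f′ j l m u v y = f (j ∷ u) (l ∷ v) (m ∷ y)

≈ₚ-isEquivalence : IsEquivalence _≈ₚ_
≈ₚ-isEquivalence = record
  { refl = λ _ _ → refl
  ; sym = λ F≈G a α → sym (F≈G a α)
  ; trans = λ F≈G G≈H a α → trans (F≈G a α) (G≈H a α)
  }

*ₚ-cong : ∀ {F F′ G G′} → F ≈ₚ F′ → G ≈ₚ G′ → (F *ₚ G) ≈ₚ (F′ *ₚ G′)
*ₚ-cong {F} {F′} {G} {G′} F≈F′ G≈G′ a α =
  trans (*ₚ-coeff F G a α)
  (trans (∑≤-cong a (λ k → ∑split-cong α (λ x y → cong₂ _*_ (F≈F′ k x) (G≈G′ (a ∸ k) y))))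
         (sym (*ₚ-coeff F′ G′ a α)))

*ₚ-comm : ∀ F G → (F *ₚ G) ≈ₚ (G *ₚ F)
*ₚ-comm F G a α =
  begin
    (F *ₚ G) a α
  ≡⟨ *ₚ-coeff F G a α ⟩
    ∑[ k ≤ a ] ∑[ x · y ≔ α ] F k x * G (a ∸ k) y
  ≡⟨ ∑≤-cong a (λ k → ∑split-swap α _) ⟩
    ∑[ k ≤ a ] ∑[ x · y ≔ α ] F k y * G (a ∸ k) x
  ≡⟨ ∑≤-reverse a (λ k k′ → ∑[ x · y ≔ α ] F k y * G k′ x) ⟩
    ∑[ k ≤ a ] ∑[ x · y ≔ α ] F (a ∸ k) y * G k x
  ≡⟨ ∑≤-cong a (λ k → ∑split-cong α (λ x y → ℤₚ.*-comm (F (a ∸ k) y) (G k x))) ⟩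
    ∑[ k ≤ a ] ∑[ x · y ≔ α ] G k x * F (a ∸ k) y
  ≡⟨ *ₚ-coeff G F a α ⟨
    (G *ₚ F) a α
  ∎
  where open ≡-Reasoning

tripleProduct : PS → PS → PS → PS
tripleProduct F G H a α =
  ∑[ j ≤ a ] ∑[ u · w ≔ α ] ∑[ l ≤ a ∸ j ] ∑[ v · y ≔ w ] F j u * G l v * H (a ∸ j ∸ l) y

*ₚ-assocˡ-coeff : ∀ F G H → ((F *ₚ G) *ₚ H) ≈ₚ tripleProduct F G H
*ₚ-assocˡ-coeff F G H a α =
  begin
    ((F *ₚ G) *ₚ H) a α
  ≡⟨ *ₚ-coeff (F *ₚ G) H a α ⟩
    ∑[ k ≤ a ] ∑[ x · y ≔ α ] (F *ₚ G) k x * H (a ∸ k) y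
  ≡⟨ ∑≤-cong a (λ k → ∑split-cong α (λ x y → expandLeft k x (H (a ∸ k) y))) ⟩
    ∑[ k ≤ a ] ∑[ x · y ≔ α ] ∑[ j ≤ k ] ∑[ u · v ≔ x ] F j u * G (k ∸ j) v * H (a ∸ k) y
  ≡⟨ ∑≤-cong a (λ k → ∑split-∑≤-comm α k _) ⟩
    ∑[ k ≤ a ] ∑[ j ≤ k ] ∑[ x · y ≔ α ] ∑[ u · v ≔ x ] F j u * G (k ∸ j) v * H (a ∸ k) y
  ≡⟨ ∑≤-cong a (λ k → ∑≤-cong k (λ j → ∑split-assoc α _)) ⟩
    ∑[ k ≤ a ] ∑[ j ≤ k ] ∑[ u · w ≔ α ] ∑[ v · y ≔ w ] F j u * G (k ∸ j) v * H (a ∸ k) y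
  ≡⟨ ∑≤-triangle a (λ j l m → ∑[ u · w ≔ α ] ∑[ v · y ≔ w ] F j u * G l v * H m y) ⟩
    ∑[ j ≤ a ] ∑[ l ≤ a ∸ j ] ∑[ u · w ≔ α ] ∑[ v · y ≔ w ] F j u * G l v * H (a ∸ j ∸ l) y
  ≡⟨ ∑≤-cong a (λ j → ∑split-∑≤-comm α (a ∸ j) _) ⟨
    tripleProduct F G H a α
  ∎
  where
  open ≡-Reasoning
  expandLeft : ∀ k x c → (F *ₚ G) k x * c ≡ ∑[ j ≤ k ] ∑[ u · v ≔ x ] F j u * G (k ∸ j) v * c
  expandLeft k x c =
    trans (cong (_* c) (*ₚ-coeff F G k x))
          (trans (*-distribʳ-∑≤ k c _) (∑≤-cong k (λ j → *-distribʳ-∑split x c _)))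

*ₚ-assocʳ-coeff : ∀ F G H → (F *ₚ (G *ₚ H)) ≈ₚ tripleProduct F G H
*ₚ-assocʳ-coeff F G H a α =
  trans (*ₚ-coeff F (G *ₚ H) a α)
        (∑≤-cong a (λ j → ∑split-cong α (λ u w → expandRight j u w)))
  where
  expandRight : ∀ j u w → F j u * (G *ₚ H) (a ∸ j) w ≡ ∑[ l ≤ a ∸ j ] ∑[ v · y ≔ w ] F j u * G l v * H (a ∸ j ∸ l) y
  expandRight j u w =
    trans (cong (F j u *_) (*ₚ-coeff G H (a ∸ j) w))
    (trans (*-distribˡ-∑≤ (a ∸ j) (F j u) _)
           (∑≤-cong (a ∸ j) (λ l → trans (*-distribˡ-∑split w (F j u) _)
                                          (∑split-cong w (λ v y → sym (ℤₚ.*-assoc (F j u) _ _))))))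

*ₚ-assoc : ∀ F G H → ((F *ₚ G) *ₚ H) ≈ₚ (F *ₚ (G *ₚ H))
*ₚ-assoc F G H a α = trans (*ₚ-assocˡ-coeff F G H a α) (sym (*ₚ-assocʳ-coeff F G H a α))

*ₚ-commutativeSemigroup : CommutativeSemigroup 0ℓ 0ℓ
*ₚ-commutativeSemigroup = record
  { Carrier = PS
  ; _≈_ = _≈ₚ_
  ; _∙_ = _*ₚ_
  ; isCommutativeSemigroup = record
    { isSemigroup = record
      { isMagma = record { isEquivalence = ≈ₚ-isEquivalence ; ∙-cong = *ₚ-cong }
      ; assoc = *ₚ-assoc
      }
    ; comm = *ₚ-comm
    }
  }

*ₚ-interchange : ∀ F G H K → ((F *ₚ G) *ₚ (H *ₚ K)) ≈ₚ ((F *ₚ H) *ₚ (G *ₚ K))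
*ₚ-interchange = interchange *ₚ-commutativeSemigroup

*ₚ-zeroʳ : ∀ F → (F *ₚ 0ₚ) ≈ₚ 0ₚ
*ₚ-zeroʳ F a α =
  trans (*ₚ-coeff F 0ₚ a α) (∑≤-zero a (λ k _ → ∑split-zero α (λ x y → ℤₚ.*-zeroʳ (F k x))))

*ₚ-distribˡ-∑≤ : ∀ F n (G : ℕ → PS) a α →
  (F *ₚ (λ b β → ∑[ k ≤ n ] G k b β)) a α ≡ ∑[ k ≤ n ] (F *ₚ G k) a α
*ₚ-distribˡ-∑≤ F n G a α =
  begin
    (F *ₚ (λ b β → ∑[ k ≤ n ] G k b β)) a α
  ≡⟨ *ₚ-coeff F _ a α ⟩
    ∑[ j ≤ a ] ∑[ x · y ≔ α ] F j x * (∑[ k ≤ n ] G k (a ∸ j) y)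
  ≡⟨ ∑≤-cong a (λ j → ∑split-cong α (λ x y → *-distribˡ-∑≤ n (F j x) _)) ⟩
    ∑[ j ≤ a ] ∑[ x · y ≔ α ] ∑[ k ≤ n ] F j x * G k (a ∸ j) y
  ≡⟨ ∑≤-cong a (λ j → ∑split-∑≤-comm α n _) ⟩
    ∑[ j ≤ a ] ∑[ k ≤ n ] ∑[ x · y ≔ α ] F j x * G k (a ∸ j) y
  ≡⟨ ∑≤-comm a n _ ⟩
    ∑[ k ≤ n ] ∑[ j ≤ a ] ∑[ x · y ≔ α ] F j x * G k (a ∸ j) y
  ≡⟨ ∑≤-cong n (λ k → *ₚ-coeff F (G k) a α) ⟨
    ∑[ k ≤ n ] (F *ₚ G k) a α
  ∎
  where open ≡-Reasoning

≡ᵇ-refl : ∀ n → (n ≡ᵇ n) ≡ true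
≡ᵇ-refl n = Equivalence.to Boolₚ.T-≡ (ℕₚ.≡⇒≡ᵇ n n refl)

≢⇒≡ᵇ-false : ∀ {m n} → m ≢ n → (m ≡ᵇ n) ≡ false
≢⇒≡ᵇ-false {m} {n} m≢n = Boolₚ.¬-not (m≢n ∘ ℕₚ.≡ᵇ⇒≡ m n ∘ Equivalence.from Boolₚ.T-≡)

≤⇒≤ᵇ-true : ∀ {m n} → m ≤ n → (m ≤ᵇ n) ≡ true
≤⇒≤ᵇ-true m≤n = Equivalence.to Boolₚ.T-≡ (ℕₚ.≤⇒≤ᵇ m≤n)

>⇒≤ᵇ-false : ∀ {m n} → n < m → (m ≤ᵇ n) ≡ false
>⇒≤ᵇ-false {m} {n} n<m = Boolₚ.¬-not (ℕₚ.<⇒≱ n<m ∘ ℕₚ.≤ᵇ⇒≤ m n ∘ Equivalence.from Boolₚ.T-≡)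

≤ᵇ-suc : ∀ m n → (m ≤ᵇ n) ≡ (suc m ≤ᵇ suc n)
≤ᵇ-suc zero n = refl
≤ᵇ-suc (suc m) n = refl

βmonomial : ℤ → ℕ → PS
βmonomial c s k x = c * δ ((k ≡ᵇ s) ∧ allZero x)

βmonomial-≢ : ∀ c {s k} x → k ≢ s → βmonomial c s k x ≡ 0ℤ
βmonomial-≢ c x k≢s = trans (cong (λ b → c * δ (b ∧ allZero x)) (≢⇒≡ᵇ-false k≢s)) (ℤₚ.*-zeroʳ c)

∑split-allZero : ∀ α (h : Mono → ℤ) → ∑[ x · y ≔ α ] δ (allZero x) * h y ≡ h α
∑split-allZero [] h = ℤₚ.*-identityˡ (h [])
∑split-allZero (e ∷ α) h =
  trans (∑≤-single e 0 z≤n (λ { zero _ 0≢0 → ⊥-elim (0≢0 refl)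
                              ; (suc k) _ _ → ∑split-zero α (λ x y → refl) }))
        (∑split-allZero α (h ∘ (e ∷_)))

∑split-βmonomial : ∀ c s α (h : Mono → ℤ) → ∑[ x · y ≔ α ] βmonomial c s s x * h y ≡ c * h α
∑split-βmonomial c s α h =
  begin
    ∑[ x · y ≔ α ] βmonomial c s s x * h y
  ≡⟨ ∑split-cong α (λ x y → trans (cong (λ b → c * δ (b ∧ allZero x) * h y) (≡ᵇ-refl s))
                                   (ℤₚ.*-assoc c _ _)) ⟩
    ∑[ x · y ≔ α ] c * (δ (allZero x) * h y)
  ≡⟨ *-distribˡ-∑split α c _ ⟨
    c * (∑[ x · y ≔ α ] δ (allZero x) * h y)
  ≡⟨ cong (c *_) (∑split-allZero α h) ⟩
    c * h α
  ∎
  where open ≡-Reasoning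

βmonomial-*ₚ : ∀ c s H a α → s ≤ a → (βmonomial c s *ₚ H) a α ≡ c * H (a ∸ s) α
βmonomial-*ₚ c s H a α s≤a =
  trans (*ₚ-coeff (βmonomial c s) H a α)
  (trans (∑≤-single a s s≤a (λ k _ k≢s → ∑split-zero α (λ x y →
            trans (cong (_* H (a ∸ k) y) (βmonomial-≢ c x k≢s)) (ℤₚ.*-zeroˡ (H (a ∸ k) y)))))
         (∑split-βmonomial c s α (H (a ∸ s))))

βmonomial-*ₚ-< : ∀ c s H a α → a < s → (βmonomial c s *ₚ H) a α ≡ 0ℤ
βmonomial-*ₚ-< c s H a α a<s =
  trans (*ₚ-coeff (βmonomial c s) H a α)
        (∑≤-zero a (λ k k≤a → ∑split-zero α (λ x y →
          trans (cong (_* H (a ∸ k) y) (βmonomial-≢ c x (ℕₚ.<⇒≢ (ℕₚ.≤-<-trans k≤a a<s))))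
                (ℤₚ.*-zeroˡ (H (a ∸ k) y)))))

*ₚ-identityˡ : ∀ H → (1ₚ *ₚ H) ≈ₚ H
*ₚ-identityˡ H a α =
  trans (*ₚ-cong {1ₚ} (λ k x → sym (ℤₚ.*-identityˡ _)) (λ _ _ → refl) a α)
        (trans (βmonomial-*ₚ 1ℤ 0 H a α z≤n) (ℤₚ.*-identityˡ _))

powₚ-βmonomial : ∀ {Q} c → Q ≈ₚ βmonomial c 1 → ∀ s → powₚ Q s ≈ₚ βmonomial (c ^ s) s
powₚ-βmonomial c Q≈cβ zero k x = sym (ℤₚ.*-identityˡ _)
powₚ-βmonomial {Q} c Q≈cβ (suc s) zero x =
  trans (*ₚ-cong Q≈cβ (powₚ-βmonomial c Q≈cβ s) 0 x)
        (trans (βmonomial-*ₚ-< c 1 (βmonomial (c ^ s) s) 0 x (s≤s z≤n)) (sym (ℤₚ.*-zeroʳ (c ^ suc s))))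
powₚ-βmonomial {Q} c Q≈cβ (suc s) (suc k) x =
  trans (*ₚ-cong Q≈cβ (powₚ-βmonomial c Q≈cβ s) (suc k) x)
        (trans (βmonomial-*ₚ c 1 (βmonomial (c ^ s) s) (suc k) x (s≤s z≤n)) (sym (ℤₚ.*-assoc c (c ^ s) _)))

scale-powₚ-βₚ : ∀ c s → scale c (powₚ βₚ s) ≈ₚ βmonomial c s
scale-powₚ-βₚ c s k x =
  cong (c *_) (trans (powₚ-βmonomial 1ℤ (λ _ _ → sym (ℤₚ.*-identityˡ _)) s k x)
                     (trans (cong (_* δ ((k ≡ᵇ s) ∧ allZero x)) (ℤₚ.^-zeroˡ s)) (ℤₚ.*-identityˡ _)))

exponent : ℕ → Mono → ℕ
exponent zero α = 0
exponent (suc q) [] = 0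
exponent (suc zero) (e ∷ α) = e
exponent (suc (suc q)) (e ∷ α) = exponent (suc q) α

lowerExponent : ℕ → ℕ → Mono → Mono
lowerExponent zero l α = α
lowerExponent (suc q) l [] = []
lowerExponent (suc zero) l (e ∷ α) = (e ∸ l) ∷ α
lowerExponent (suc (suc q)) l (e ∷ α) = e ∷ lowerExponent (suc q) l α

lowerExponent-0 : ∀ q α → lowerExponent q 0 α ≡ α
lowerExponent-0 zero α = refl
lowerExponent-0 (suc q) [] = refl
lowerExponent-0 (suc zero) (e ∷ α) = refl
lowerExponent-0 (suc (suc q)) (e ∷ α) = cong (e ∷_) (lowerExponent-0 (suc q) α)

exponent-lowerExponent : ∀ q m α → exponent q (lowerExponent q m α) ≡ exponent q α ∸ m
exponent-lowerExponent zero m α = sym (ℕₚ.0∸n≡0 m)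
exponent-lowerExponent (suc q) m [] = sym (ℕₚ.0∸n≡0 m)
exponent-lowerExponent (suc zero) m (e ∷ α) = refl
exponent-lowerExponent (suc (suc q)) m (e ∷ α) = exponent-lowerExponent (suc q) m α

lowerExponent-+ : ∀ q m l α → lowerExponent q l (lowerExponent q m α) ≡ lowerExponent q (m ℕ.+ l) α
lowerExponent-+ zero m l α = refl
lowerExponent-+ (suc q) m l [] = refl
lowerExponent-+ (suc zero) m l (e ∷ α) = cong (_∷ α) (ℕₚ.∸-+-assoc e m l)
lowerExponent-+ (suc (suc q)) m l (e ∷ α) = cong (e ∷_) (lowerExponent-+ (suc q) m l α)

∑split-isVar : ∀ q α (h : Mono → ℤ) →
  ∑[ x · y ≔ α ] δ (isVar q x) * h y ≡ (if 1 ≤ᵇ exponent q α then h (lowerExponent q 1 α) else 0ℤ)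
∑split-isVar zero α h = ∑split-zero α (λ x y → refl)
∑split-isVar (suc q) [] h = refl
∑split-isVar (suc zero) (zero ∷ α) h = ∑split-zero α (λ x y → refl)
∑split-isVar (suc zero) (suc e ∷ α) h =
  trans (∑≤-single (suc e) 1 {λ k → ∑[ x · y ≔ α ] δ (isVar 1 (k ∷ x)) * h ((suc e ∸ k) ∷ y)} (s≤s z≤n)
          (λ { zero _ _ → ∑split-zero α (λ x y → refl)
             ; (suc zero) _ 1≢1 → ⊥-elim (1≢1 refl)
             ; (suc (suc k)) _ _ → ∑split-zero α (λ x y → refl) }))
        (∑split-allZero α (h ∘ (e ∷_)))
∑split-isVar (suc (suc q)) (e ∷ α) h =
  trans (∑≤-single e 0 z≤n (λ { zero _ 0≢0 → ⊥-elim (0≢0 refl)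
                              ; (suc k) _ _ → ∑split-zero α (λ x y → refl) }))
        (∑split-isVar (suc q) α (h ∘ (e ∷_)))

xₚ-*ₚ : ∀ q H a α → (xₚ q *ₚ H) a α ≡ (if 1 ≤ᵇ exponent q α then H a (lowerExponent q 1 α) else 0ℤ)
xₚ-*ₚ q H a α =
  trans (*ₚ-coeff (xₚ q) H a α)
  (trans (∑≤-single a 0 z≤n (λ { zero _ 0≢0 → ⊥-elim (0≢0 refl)
                               ; (suc k) _ _ → ∑split-zero α (λ x y → refl) }))
         (∑split-isVar q α (H a)))

powₚ-xₚ-*ₚ : ∀ q l H a α →
  (powₚ (xₚ q) l *ₚ H) a α ≡ (if l ≤ᵇ exponent q α then H a (lowerExponent q l α) else 0ℤ)
powₚ-xₚ-*ₚ q zero H a α = trans (*ₚ-identityˡ H a α) (cong (H a) (sym (lowerExponent-0 q α)))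
powₚ-xₚ-*ₚ q (suc l) H a α =
  trans (*ₚ-assoc (xₚ q) (powₚ (xₚ q) l) H a α)
        (trans (xₚ-*ₚ q (powₚ (xₚ q) l *ₚ H) a α) (peel (exponent q α) refl))
  where
  peel : ∀ e → exponent q α ≡ e →
    (if 1 ≤ᵇ e then (powₚ (xₚ q) l *ₚ H) a (lowerExponent q 1 α) else 0ℤ)
    ≡ (if suc l ≤ᵇ e then H a (lowerExponent q (suc l) α) else 0ℤ)
  peel zero _ = refl
  peel (suc e) α[q]≡1+e =
    begin
      (powₚ (xₚ q) l *ₚ H) a (lowerExponent q 1 α)
    ≡⟨ powₚ-xₚ-*ₚ q l H a (lowerExponent q 1 α) ⟩
      (if l ≤ᵇ exponent q (lowerExponent q 1 α) then H a (lowerExponent q l (lowerExponent q 1 α)) else 0ℤ)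
    ≡⟨ cong₂ (λ n β → if l ≤ᵇ n then H a β else 0ℤ)
             (trans (exponent-lowerExponent q 1 α) (cong (_∸ 1) α[q]≡1+e)) (lowerExponent-+ q 1 l α) ⟩
      (if l ≤ᵇ e then H a (lowerExponent q (suc l) α) else 0ℤ)
    ≡⟨ cong (λ b → if b then H a (lowerExponent q (suc l) α) else 0ℤ) (≤ᵇ-suc l e) ⟩
      (if suc l ≤ᵇ suc e then H a (lowerExponent q (suc l) α) else 0ℤ)
    ∎
    where open ≡-Reasoning

supportIn'-suc : ∀ p q pos α → q < pos → supportIn' (suc q) p pos α ≡ supportIn' q p pos α
supportIn'-suc p q pos [] _ = refl
supportIn'-suc p q pos (e ∷ α) q<pos
  rewrite ≤⇒≤ᵇ-true q<pos | ≤⇒≤ᵇ-true (ℕₚ.<⇒≤ q<pos) =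
  cong (((e ≡ᵇ 0) ∨ (pos ≤ᵇ p)) ∧_) (supportIn'-suc p q (suc pos) α (ℕₚ.m<n⇒m<1+n q<pos))

∧-swap : ∀ x y z → x ∧ (y ∧ z) ≡ y ∧ (x ∧ z)
∧-swap = x∙yz≈y∙xz (CommutativeMonoid.commutativeSemigroup Boolₚ.∧-commutativeMonoid)

-- The list starts at variable x_pos, so its (r+1)-st entry is the exponent of x_q.
supportIn'-lowerExponent : ∀ p r pos q l α → pos ℕ.+ r ≡ q → q ≤ p →
  supportIn' (suc q) p pos (lowerExponent (suc r) l α)
  ≡ (((exponent (suc r) α ∸ l) ≡ᵇ 0) ∧ supportIn' q p pos α)
supportIn'-lowerExponent p r pos q l [] _ _ rewrite ℕₚ.0∸n≡0 l = refl
supportIn'-lowerExponent p zero pos q l (e ∷ α) pos+0≡q q≤p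
  with trans (sym (ℕₚ.+-identityʳ pos)) pos+0≡q
... | refl
  rewrite >⇒≤ᵇ-false {suc pos} {pos} (ℕₚ.n<1+n pos) | ≤⇒≤ᵇ-true (ℕₚ.≤-refl {pos}) | ≤⇒≤ᵇ-true q≤p
        | Boolₚ.∨-identityʳ ((e ∸ l) ≡ᵇ 0) | Boolₚ.∨-zeroʳ (e ≡ᵇ 0) =
  cong (((e ∸ l) ≡ᵇ 0) ∧_) (supportIn'-suc p pos (suc pos) α (ℕₚ.n<1+n pos))
supportIn'-lowerExponent p (suc r) pos .(pos ℕ.+ suc r) l (e ∷ α) refl q≤p
  rewrite >⇒≤ᵇ-false {suc (pos ℕ.+ suc r)} {pos} (ℕₚ.m<n⇒m<1+n (ℕₚ.m<m+n pos (s≤s z≤n)))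
        | >⇒≤ᵇ-false {pos ℕ.+ suc r} {pos} (ℕₚ.m<m+n pos (s≤s z≤n))
        | supportIn'-lowerExponent p r (suc pos) (pos ℕ.+ suc r) l α (sym (ℕₚ.+-suc pos r)) q≤p =
  ∧-swap ((e ≡ᵇ 0) ∨ false) ((exponent (suc r) α ∸ l) ≡ᵇ 0) (supportIn' (pos ℕ.+ suc r) p (suc pos) α)

exponent≤deg : ∀ q α → exponent q α ≤ deg α
exponent≤deg zero α = z≤n
exponent≤deg (suc q) [] = z≤n
exponent≤deg (suc zero) (e ∷ α) = ℕₚ.m≤m+n e (deg α)
exponent≤deg (suc (suc q)) (e ∷ α) = ℕₚ.≤-trans (exponent≤deg (suc q) α) (ℕₚ.m≤n+m (deg α) e)

deg-lowerExponent : ∀ q l α → l ≤ exponent (suc q) α → deg (lowerExponent (suc q) l α) ≡ deg α ∸ l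
deg-lowerExponent q .0 [] z≤n = refl
deg-lowerExponent zero l (e ∷ α) l≤e = sym (ℕₚ.+-∸-comm (deg α) l≤e)
deg-lowerExponent (suc q) l (e ∷ α) l≤α[q] =
  trans (cong (e ℕ.+_) (deg-lowerExponent q l α l≤α[q]))
        (sym (ℕₚ.+-∸-assoc e (ℕₚ.≤-trans l≤α[q] (exponent≤deg (suc q) α))))

∸-≡ᵇ-∸ : ∀ l m n → l ≤ m → l ≤ n → ((m ∸ l) ≡ᵇ (n ∸ l)) ≡ (m ≡ᵇ n)
∸-≡ᵇ-∸ zero m n _ _ = refl
∸-≡ᵇ-∸ (suc l) (suc m) (suc n) (s≤s l≤m) (s≤s l≤n) = ∸-≡ᵇ-∸ l m n l≤m l≤n

hPoly-lowerExponent : ∀ q p → suc q ≤ p → ∀ r α l → l ≤ exponent (suc q) α →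
  hPoly (+ (r ∸ l)) (suc (suc q)) p 0 (lowerExponent (suc q) l α)
  ≡ δ (((exponent (suc q) α ∸ l) ≡ᵇ 0) ∧ supportIn (suc q) p α ∧ ((deg α ∸ l) ≡ᵇ (r ∸ l)))
hPoly-lowerExponent q p q<p r α l l≤α[q] =
  cong δ (trans (cong₂ (λ b d → b ∧ (d ≡ᵇ (r ∸ l)))
                       (supportIn'-lowerExponent p q 1 (suc q) l α refl q<p)
                       (deg-lowerExponent q l α l≤α[q]))
                (Boolₚ.∧-assoc ((exponent (suc q) α ∸ l) ≡ᵇ 0) (supportIn (suc q) p α) _))

-- h_r(x_q,…,x_p) = Σ_l x_q^l h_{r-l}(x_{q+1},…,x_p); in each coefficient only the term with
-- l = exponent of x_q survives.
peeledTerm : ℕ → ℕ → ℕ → ℕ → PS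
peeledTerm q p r l = powₚ (xₚ (suc q)) l *ₚ hPoly (+ (r ∸ l)) (suc (suc q)) p

peeledTerm-≢ : ∀ q p → suc q ≤ p → ∀ r α l → l ≢ exponent (suc q) α → peeledTerm q p r l 0 α ≡ 0ℤ
peeledTerm-≢ q p q<p r α l l≢α[q] rewrite powₚ-xₚ-*ₚ (suc q) l (hPoly (+ (r ∸ l)) (suc (suc q)) p) 0 α
  with l ℕ.≤? exponent (suc q) α
... | no l≰α[q] rewrite >⇒≤ᵇ-false (ℕₚ.≰⇒> l≰α[q]) = refl
... | yes l≤α[q] rewrite ≤⇒≤ᵇ-true l≤α[q] =
  trans (hPoly-lowerExponent q p q<p r α l l≤α[q])
        (cong (λ b → δ (b ∧ supportIn (suc q) p α ∧ ((deg α ∸ l) ≡ᵇ (r ∸ l)))) (≢⇒≡ᵇ-false (ℕₚ.m>n⇒m∸n≢0 (ℕₚ.≤∧≢⇒< l≤α[q] l≢α[q]))))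

peeledTerm-exponent : ∀ q p → suc q ≤ p → ∀ r α → exponent (suc q) α ≤ r →
  peeledTerm q p r (exponent (suc q) α) 0 α ≡ hPoly (+ r) (suc q) p 0 α
peeledTerm-exponent q p q<p r α α[q]≤r
  rewrite powₚ-xₚ-*ₚ (suc q) (exponent (suc q) α) (hPoly (+ (r ∸ exponent (suc q) α)) (suc (suc q)) p) 0 α
        | ≤⇒≤ᵇ-true (ℕₚ.≤-refl {exponent (suc q) α})
        | hPoly-lowerExponent q p q<p r α (exponent (suc q) α) ℕₚ.≤-refl
        | ℕₚ.n∸n≡0 (exponent (suc q) α)
        | ∸-≡ᵇ-∸ (exponent (suc q) α) (deg α) r (exponent≤deg (suc q) α) α[q]≤r = refl

hPoly-peel : ∀ q p → suc q ≤ p → ∀ r a α → ∑[ l ≤ r ] peeledTerm q p r l a α ≡ hPoly (+ r) (suc q) p a α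
hPoly-peel q p q<p r (suc a) α =
  ∑≤-zero r (λ l _ → trans (powₚ-xₚ-*ₚ (suc q) l _ (suc a) α)
                           (Boolₚ.if-eta (l ≤ᵇ exponent (suc q) α)))
hPoly-peel q p q<p r zero α with exponent (suc q) α ℕ.≤? r
... | yes α[q]≤r =
  trans (∑≤-single r (exponent (suc q) α) α[q]≤r (λ l _ → peeledTerm-≢ q p q<p r α l))
        (peeledTerm-exponent q p q<p r α α[q]≤r)
... | no α[q]≰r =
  trans (∑≤-zero r (λ l l≤r → peeledTerm-≢ q p q<p r α l (λ l≡α[q] → α[q]≰r (subst (_≤ r) l≡α[q] l≤r))))
        (sym (cong δ (trans (cong (supportIn (suc q) p α ∧_) (≢⇒≡ᵇ-false deg≢r))
                            (Boolₚ.∧-zeroʳ (supportIn (suc q) p α)))))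
  where
  deg≢r : deg α ≢ r
  deg≢r deg≡r = α[q]≰r (subst (exponent (suc q) α ≤_) deg≡r (exponent≤deg (suc q) α))

supportIn'-empty : ∀ p q → p < q → ∀ pos α → supportIn' q p pos α ≡ allZero α
supportIn'-empty p q p<q pos [] = refl
supportIn'-empty p q p<q pos (e ∷ α) =
  cong₂ _∧_ (trans (cong ((e ≡ᵇ 0) ∨_) outside) (Boolₚ.∨-identityʳ (e ≡ᵇ 0)))
            (supportIn'-empty p q p<q (suc pos) α)
  where
  outside : ((q ≤ᵇ pos) ∧ (pos ≤ᵇ p)) ≡ false
  outside with q ℕ.≤? pos
  ... | yes q≤pos rewrite >⇒≤ᵇ-false {pos} {p} (ℕₚ.<-≤-trans p<q q≤pos) = Boolₚ.∧-zeroʳ (q ≤ᵇ pos)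
  ... | no q≰pos rewrite >⇒≤ᵇ-false {q} {pos} (ℕₚ.≰⇒> q≰pos) = refl

allZero⇒deg≡0 : ∀ α → allZero α ≡ true → deg α ≡ 0
allZero⇒deg≡0 [] _ = refl
allZero⇒deg≡0 (zero ∷ α) α≡0 = allZero⇒deg≡0 α α≡0

hPoly-empty : ∀ q p → p < q → ∀ r a α → hPoly (+ r) q p a α ≡ 1ᵤ r a α
hPoly-empty q p p<q r a α rewrite supportIn'-empty p q p<q 1 α = byDegree r a
  where
  byDegree : ∀ r a → δ ((a ≡ᵇ 0) ∧ allZero α ∧ (deg α ≡ᵇ r)) ≡ 1ᵤ r a α
  byDegree zero (suc a) = refl
  byDegree (suc r) (suc a) = refl
  byDegree zero zero with allZero α in α≡0
  ... | true rewrite allZero⇒deg≡0 α α≡0 = refl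
  ... | false = refl
  byDegree (suc r) zero with allZero α in α≡0
  ... | true rewrite allZero⇒deg≡0 α α≡0 = refl
  ... | false = refl

m>n⇒m∸n≡1+[m∸1+n] : ∀ {m n} → n < m → m ∸ n ≡ suc (m ∸ suc n)
m>n⇒m∸n≡1+[m∸1+n] {suc m} (s≤s n≤m) = ℕₚ.+-∸-assoc 1 n≤m

applyUpTo-cong : ∀ {f g : ℕ → ℕ} → (∀ k → f k ≡ g k) → ∀ n → applyUpTo f n ≡ applyUpTo g n
applyUpTo-cong f≗g zero = refl
applyUpTo-cong f≗g (suc n) = cong₂ _∷_ (f≗g 0) (applyUpTo-cong (f≗g ∘ suc) n)

map-+-upTo : ∀ q n → map (q ℕ.+_) (upTo (suc n)) ≡ q ∷ map (suc q ℕ.+_) (upTo n)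
map-+-upTo q n =
  begin
    map (q ℕ.+_) (upTo (suc n))
  ≡⟨ Listₚ.map-upTo (q ℕ.+_) (suc n) ⟩
    applyUpTo (q ℕ.+_) (suc n)
  ≡⟨ cong₂ _∷_ (ℕₚ.+-identityʳ q) (applyUpTo-cong (ℕₚ.+-suc q) n) ⟩
    q ∷ applyUpTo (suc q ℕ.+_) n
  ≡⟨ cong (q ∷_) (Listₚ.map-upTo (suc q ℕ.+_) n) ⟨
    q ∷ map (suc q ℕ.+_) (upTo n)
  ∎
  where open ≡-Reasoning

rangeFromTo-empty : ∀ {q p} → p < q → rangeFromTo q p ≡ []
rangeFromTo-empty {q} {p} p<q rewrite >⇒≤ᵇ-false {q} {p} p<q = refl

rangeFromTo-step : ∀ {q p} → q ≤ p → rangeFromTo q p ≡ q ∷ rangeFromTo (suc q) p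
rangeFromTo-step {q} {p} q≤p rewrite ≤⇒≤ᵇ-true q≤p = trans (map-+-upTo q (p ∸ q)) (cong (q ∷_) rest)
  where
  rest : map (suc q ℕ.+_) (upTo (p ∸ q)) ≡ rangeFromTo (suc q) p
  rest with suc q ℕ.≤? p
  ... | yes q<p rewrite ≤⇒≤ᵇ-true q<p | m>n⇒m∸n≡1+[m∸1+n] q<p = refl
  ... | no q≮p rewrite >⇒≤ᵇ-false {suc q} {p} (ℕₚ.≰⇒> q≮p)
                     | ℕₚ.≤-antisym q≤p (ℕₚ.≤-pred (ℕₚ.≰⇒> q≮p)) | ℕₚ.n∸n≡0 p = refl

linearFactor : ℕ → PS
linearFactor l = 1ₚ +ₚ βₚ *ₚ xₚ l

Cfac-step : ∀ {q p} → q ≤ p → Cfac p q ≡ linearFactor q *ₚ Cfac p (suc q)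
Cfac-step q≤p = cong (foldr (λ i acc → linearFactor i *ₚ acc) 1ₚ) (rangeFromTo-step q≤p)

Cfac-empty : ∀ {q p} → p < q → Cfac p q ≡ 1ₚ
Cfac-empty p<q = cong (foldr (λ i acc → linearFactor i *ₚ acc) 1ₚ) (rangeFromTo-empty p<q)

Bᵤ-step : ∀ {q p} → q ≤ p → Bᵤ q p ≡ factorᵤ q *ᵤ Bᵤ (suc q) p
Bᵤ-step q≤p = cong (foldr (λ i acc → factorᵤ i *ᵤ acc) 1ᵤ) (rangeFromTo-step q≤p)

Bᵤ-empty : ∀ {q p} → p < q → Bᵤ q p ≡ 1ᵤ
Bᵤ-empty p<q = cong (foldr (λ i acc → factorᵤ i *ᵤ acc) 1ᵤ) (rangeFromTo-empty p<q)

*ᵤ-coeff : ∀ A B n a α → (A *ᵤ B) n a α ≡ ∑[ k ≤ n ] (A k *ₚ B (n ∸ k)) a α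
*ᵤ-coeff A B n a α = trans (foldr-coeff (range0 n)) (Σℤ-map-range0 n _)
  where
  foldr-coeff : ∀ ks → foldr (λ k acc → A k *ₚ B (n ∸ k) +ₚ acc) 0ₚ ks a α
                       ≡ Σℤ (map (λ k → (A k *ₚ B (n ∸ k)) a α) ks)
  foldr-coeff [] = refl
  foldr-coeff (k ∷ ks) = cong (_+_ ((A k *ₚ B (n ∸ k)) a α)) (foldr-coeff ks)

Bᵤ-coeff′ : ∀ t q p → p ∸ q ≡ t → ∀ r → Bᵤ (suc q) p r ≈ₚ (Cfac p (suc q) *ₚ hPoly (+ r) (suc q) p)
Bᵤ-coeff′ zero q p p∸q≡0 r a α =
  begin
    Bᵤ (suc q) p r a α
  ≡⟨ cong (λ B → B r a α) (Bᵤ-empty p<1+q) ⟩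
    1ᵤ r a α
  ≡⟨ hPoly-empty (suc q) p p<1+q r a α ⟨
    hPoly (+ r) (suc q) p a α
  ≡⟨ *ₚ-identityˡ (hPoly (+ r) (suc q) p) a α ⟨
    (1ₚ *ₚ hPoly (+ r) (suc q) p) a α
  ≡⟨ cong (λ C → (C *ₚ hPoly (+ r) (suc q) p) a α) (Cfac-empty p<1+q) ⟨
    (Cfac p (suc q) *ₚ hPoly (+ r) (suc q) p) a α
  ∎
  where
  open ≡-Reasoning
  p<1+q : p < suc q
  p<1+q = s≤s (ℕₚ.m∸n≡0⇒m≤n p∸q≡0)
Bᵤ-coeff′ (suc t) q p p∸q≡1+t r a α =
  begin
    Bᵤ (suc q) p r a α
  ≡⟨ cong (λ B → B r a α) (Bᵤ-step q<p) ⟩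
    (factorᵤ (suc q) *ᵤ Bᵤ (suc (suc q)) p) r a α
  ≡⟨ *ᵤ-coeff (factorᵤ (suc q)) (Bᵤ (suc (suc q)) p) r a α ⟩
    ∑[ k ≤ r ] (factorᵤ (suc q) k *ₚ Bᵤ (suc (suc q)) p (r ∸ k)) a α
  ≡⟨ ∑≤-cong r (λ k → *ₚ-cong {factorᵤ (suc q) k} (λ _ _ → refl) (IH (r ∸ k)) a α) ⟩
    ∑[ k ≤ r ] ((A *ₚ powₚ (xₚ (suc q)) k) *ₚ (C′ *ₚ hPoly (+ (r ∸ k)) (suc (suc q)) p)) a α
  ≡⟨ ∑≤-cong r (λ k → *ₚ-interchange A (powₚ (xₚ (suc q)) k) C′ _ a α) ⟩
    ∑[ k ≤ r ] ((A *ₚ C′) *ₚ peeledTerm q p r k) a α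
  ≡⟨ *ₚ-distribˡ-∑≤ (A *ₚ C′) r (peeledTerm q p r) a α ⟨
    ((A *ₚ C′) *ₚ (λ b β → ∑[ k ≤ r ] peeledTerm q p r k b β)) a α
  ≡⟨ *ₚ-cong {A *ₚ C′} (λ _ _ → refl) (hPoly-peel q p q<p r) a α ⟩
    ((A *ₚ C′) *ₚ hPoly (+ r) (suc q) p) a α
  ≡⟨ cong (λ C → (C *ₚ hPoly (+ r) (suc q) p) a α) (Cfac-step q<p) ⟨
    (Cfac p (suc q) *ₚ hPoly (+ r) (suc q) p) a α
  ∎
  where
  open ≡-Reasoning
  q<p : q < p
  q<p = ℕₚ.m∸n≢0⇒n<m (λ p∸q≡0 → ℕₚ.1+n≢0 (trans (sym p∸q≡1+t) p∸q≡0))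
  A = linearFactor (suc q)
  C′ = Cfac p (suc (suc q))
  IH : ∀ r′ → Bᵤ (suc (suc q)) p r′ ≈ₚ (C′ *ₚ hPoly (+ r′) (suc (suc q)) p)
  IH = Bᵤ-coeff′ t (suc q) p (trans (sym (ℕₚ.pred[m∸n]≡m∸[1+n] p q)) (cong ℕ.pred p∸q≡1+t))

coefU-Bᵤ : ∀ q p m → coefU (Bᵤ (suc q) p) m ≈ₚ (Cfac p (suc q) *ₚ hPoly m (suc q) p)
coefU-Bᵤ q p (+ r) = Bᵤ-coeff′ (p ∸ q) q p refl r
coefU-Bᵤ q p -[1+ n ] = λ a α → sym (*ₚ-zeroʳ (Cfac p (suc q)) a α)

powʸ-0 : ∀ A → A 0 ≡ 1ℤ → ∀ n → powʸ A n 0 ≡ 1ℤ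
powʸ-0 A A₀≡1 zero = refl
powʸ-0 A A₀≡1 (suc n) = trans (ℤₚ.+-identityʳ _) (cong₂ _*_ A₀≡1 (powʸ-0 A A₀≡1 n))

*ʸ-coeff : ∀ A B n → (A *ʸ B) n ≡ ∑[ k ≤ n ] A k * B (n ∸ k)
*ʸ-coeff A B n = Σℤ-map-range0 n (λ k → A k * B (n ∸ k))

onePlusYNeg-0 : ∀ c → onePlusYNeg c 0 ≡ 1ℤ
onePlusYNeg-0 (+ n) = powʸ-0 invOnePlusY refl n
onePlusYNeg-0 -[1+ n ] = powʸ-0 onePlusY refl (suc n)

onePlusY-*ʸ : ∀ S N → (onePlusY *ʸ S) (suc N) ≡ S (suc N) + S N
onePlusY-*ʸ S N = trans (*ʸ-coeff onePlusY S (suc N)) (cong₂ _+_ (ℤₚ.*-identityˡ (S (suc N))) (onlyLinearTerm N))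
  where
  onlyLinearTerm : ∀ N → ∑[ k ≤ N ] onePlusY (suc k) * S (N ∸ k) ≡ S N
  onlyLinearTerm zero = ℤₚ.*-identityˡ (S 0)
  onlyLinearTerm (suc N) =
    trans (cong₂ _+_ (ℤₚ.*-identityˡ (S (suc N))) (∑≤-zero N (λ _ _ → refl))) (ℤₚ.+-identityʳ _)

invOnePlusY-*ʸ : ∀ S N → (invOnePlusY *ʸ S) (suc N) + (invOnePlusY *ʸ S) N ≡ S (suc N)
invOnePlusY-*ʸ S N =
  begin
    (invOnePlusY *ʸ S) (suc N) + (invOnePlusY *ʸ S) N
  ≡⟨ cong₂ _+_ (*ʸ-coeff invOnePlusY S (suc N)) (*ʸ-coeff invOnePlusY S N) ⟩
    1ℤ * S (suc N) + (∑[ k ≤ N ] -1ℤ * invOnePlusY k * S (N ∸ k)) + T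
  ≡⟨ cong (λ z → 1ℤ * S (suc N) + z + T)
          (trans (∑≤-cong N (λ k → ℤₚ.*-assoc -1ℤ (invOnePlusY k) (S (N ∸ k)))) (sym (*-distribˡ-∑≤ N -1ℤ _))) ⟩
    1ℤ * S (suc N) + -1ℤ * T + T
  ≡⟨ cancel (S (suc N)) T ⟩
    S (suc N)
  ∎
  where
  open ≡-Reasoning
  T = ∑[ k ≤ N ] invOnePlusY k * S (N ∸ k)
  cancel : ∀ x y → 1ℤ * x + -1ℤ * y + y ≡ x
  cancel = solve-∀

onePlusYNeg-pascal : ∀ c N → onePlusYNeg c (suc N) + onePlusYNeg c N ≡ onePlusYNeg (c - 1ℤ) (suc N)
onePlusYNeg-pascal (+ zero) N = sym (onePlusY-*ʸ 1ʸ N)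
onePlusYNeg-pascal (+ suc n) N = invOnePlusY-*ʸ (powʸ invOnePlusY n) N
onePlusYNeg-pascal -[1+ n ] N rewrite ℕₚ.+-identityʳ n = sym (onePlusY-*ʸ (powʸ onePlusY (suc n)) N)

falling-pascal : ∀ d s → falling (1ℤ + d) (suc s) ≡ falling d (suc s) + + suc s * falling d s
falling-pascal d zero = lemma d
  where
  lemma : ∀ d → 1ℤ * ((1ℤ + d) - 0ℤ) ≡ 1ℤ * (d - 0ℤ) + 1ℤ * 1ℤ
  lemma = solve-∀
falling-pascal d (suc s) =
  trans (cong (_* ((1ℤ + d) - + suc s)) (falling-pascal d s)) (lemma (falling d s) d (+ s))
  where
  lemma : ∀ F d s → (F * (d - s) + (1ℤ + s) * F) * ((1ℤ + d) - (1ℤ + s))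
                    ≡ F * (d - s) * (d - (1ℤ + s)) + (1ℤ + (1ℤ + s)) * (F * (d - s))
  lemma = solve-∀

falling-0 : ∀ s → falling 0ℤ (suc s) ≡ 0ℤ
falling-0 zero = refl
falling-0 (suc s) rewrite falling-0 s = refl

ℤ-induction : (P : ℤ → Set) → P 0ℤ → (∀ d → P d → P (1ℤ + d)) → (∀ d → P (1ℤ + d) → P d) → ∀ d → P d
ℤ-induction P P0 up down (+ zero) = P0
ℤ-induction P P0 up down (+ suc n) = up (+ n) (ℤ-induction P P0 up down (+ n))
ℤ-induction P P0 up down -[1+ zero ] = down -[1+ 0 ] P0
ℤ-induction P P0 up down -[1+ suc n ] = down -[1+ suc n ] (ℤ-induction P P0 up down -[1+ n ])

-- Both sides satisfy Pascal's rule in d, so their difference does not depend on d ∈ ℤ and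
-- vanishes at d = 0.
falling≡onePlusYNeg*! : ∀ s d → falling d s ≡ onePlusYNeg (- d) s * + (s !)
falling≡onePlusYNeg*! zero d = sym (trans (ℤₚ.*-identityʳ _) (onePlusYNeg-0 (- d)))
falling≡onePlusYNeg*! (suc s) d =
  ℤₚ.i-j≡0⇒i≡j _ _
    (ℤ-induction (λ d → defect d ≡ 0ℤ) (ℤₚ.i≡j⇒i-j≡0 (falling-0 s))
                 (λ d defect≡0 → trans (defect-shift d) defect≡0)
                 (λ d defect≡0 → trans (sym (defect-shift d)) defect≡0) d)
  where
  defect : ℤ → ℤ
  defect d = falling d (suc s) - onePlusYNeg (- d) (suc s) * + (suc s !)
  defect-shift : ∀ d → defect (1ℤ + d) ≡ defect d
  defect-shift d =
    begin
      falling (1ℤ + d) (suc s) - onePlusYNeg (- (1ℤ + d)) (suc s) * + (suc s !)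
    ≡⟨ cong₂ (λ u w → u - w * + (suc s !))
             (falling-pascal d s)
             (trans (cong (λ c → onePlusYNeg c (suc s)) (neg-suc d))
                    (sym (onePlusYNeg-pascal (- d) s))) ⟩
      falling d (suc s) + + suc s * falling d s
        - (onePlusYNeg (- d) (suc s) + onePlusYNeg (- d) s) * + (suc s !)
    ≡⟨ cong₂ (λ v F → falling d (suc s) + + suc s * v - (onePlusYNeg (- d) (suc s) + onePlusYNeg (- d) s) * F)
             (falling≡onePlusYNeg*! s d) (ℤₚ.pos-* (suc s) (s !)) ⟩
      falling d (suc s) + + suc s * (onePlusYNeg (- d) s * + (s !))
        - (onePlusYNeg (- d) (suc s) + onePlusYNeg (- d) s) * (+ suc s * + (s !))
    ≡⟨ cancel (falling d (suc s)) (+ suc s) (onePlusYNeg (- d) s) (+ (s !)) (onePlusYNeg (- d) (suc s)) ⟩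
      falling d (suc s) - onePlusYNeg (- d) (suc s) * (+ suc s * + (s !))
    ≡⟨ cong (λ F → falling d (suc s) - onePlusYNeg (- d) (suc s) * F) (ℤₚ.pos-* (suc s) (s !)) ⟨
      falling d (suc s) - onePlusYNeg (- d) (suc s) * + (suc s !)
    ∎
    where
    open ≡-Reasoning
    neg-suc : ∀ d → - (1ℤ + d) ≡ - d - 1ℤ
    neg-suc = solve-∀
    cancel : ∀ u S v F w → u + S * (v * F) - (w + v) * (S * F) ≡ u - w * (S * F)
    cancel = solve-∀

-- _/ℕ_ rounds towards -∞, so for negative k the remainder has to be computed first.
*-/ℕ-cancelʳ : ∀ k n .{{_ : ℕ.NonZero n}} → (k * + n) /ℕ n ≡ k
*-/ℕ-cancelʳ (+ m) (suc n) =
  trans (cong (_/ℕ suc n) (sym (ℤₚ.pos-* m (suc n)))) (cong +_ (m*n/n≡m m (suc n)))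
*-/ℕ-cancelʳ -[1+ m ] (suc n) with suc m ℕ.* suc n ℕ.% suc n | m*n%n≡0 (suc m) (suc n)
... | .0 | refl = cong (-_ ∘ +_) (m*n/n≡m (suc m) (suc n))

binomℤ≡onePlusYNeg : ∀ d s → binomℤ d s ≡ onePlusYNeg (- d) s
binomℤ≡onePlusYNeg d s =
  trans (cong (λ z → (z /ℕ (s !)) {{s ℕₚ.!≢0}}) (falling≡onePlusYNeg*! s d))
        (*-/ℕ-cancelʳ (onePlusYNeg (- d) s) (s !) {{s ℕₚ.!≢0}})

∑binom-alternating : ∀ d N → ∑[ j ≤ N ] binomℤ d j * -1ℤ ^ (N ∸ j) ≡ onePlusYNeg (1ℤ - d) N
∑binom-alternating d zero =
  trans (ℤₚ.*-identityʳ _) (trans (binomℤ≡onePlusYNeg d 0)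
                                  (trans (onePlusYNeg-0 (- d)) (sym (onePlusYNeg-0 (1ℤ - d)))))
∑binom-alternating d (suc N) =
  begin
    ∑[ j ≤ suc N ] binomℤ d j * -1ℤ ^ (suc N ∸ j)
  ≡⟨ ∑≤-sucʳ N _ ⟩
    (∑[ j ≤ N ] binomℤ d j * -1ℤ ^ (suc N ∸ j)) + binomℤ d (suc N) * -1ℤ ^ (suc N ∸ suc N)
  ≡⟨ cong₂ _+_ (∑≤-cong-≤ N (λ j j≤N → cong (λ n → binomℤ d j * -1ℤ ^ n) (ℕₚ.+-∸-assoc 1 j≤N)))
               (cong (λ n → binomℤ d (suc N) * -1ℤ ^ n) (ℕₚ.n∸n≡0 N)) ⟩
    (∑[ j ≤ N ] binomℤ d j * (-1ℤ * -1ℤ ^ (N ∸ j))) + binomℤ d (suc N) * 1ℤ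
  ≡⟨ cong₂ _+_ (trans (∑≤-cong N (λ j → pull (binomℤ d j) (-1ℤ ^ (N ∸ j)))) (sym (*-distribˡ-∑≤ N -1ℤ _)))
               (trans (ℤₚ.*-identityʳ _) (binomℤ≡onePlusYNeg d (suc N))) ⟩
    -1ℤ * (∑[ j ≤ N ] binomℤ d j * -1ℤ ^ (N ∸ j)) + onePlusYNeg (- d) (suc N)
  ≡⟨ cong₂ (λ u c → -1ℤ * u + onePlusYNeg c (suc N)) (∑binom-alternating d N) (minus-one d) ⟩
    -1ℤ * onePlusYNeg (1ℤ - d) N + onePlusYNeg (1ℤ - d - 1ℤ) (suc N)
  ≡⟨ cong (_+_ (-1ℤ * onePlusYNeg (1ℤ - d) N)) (onePlusYNeg-pascal (1ℤ - d) N) ⟨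
    -1ℤ * onePlusYNeg (1ℤ - d) N + (onePlusYNeg (1ℤ - d) (suc N) + onePlusYNeg (1ℤ - d) N)
  ≡⟨ cancel (onePlusYNeg (1ℤ - d) (suc N)) (onePlusYNeg (1ℤ - d) N) ⟩
    onePlusYNeg (1ℤ - d) (suc N)
  ∎
  where
  open ≡-Reasoning
  pull : ∀ b s → b * (-1ℤ * s) ≡ -1ℤ * (b * s)
  pull = solve-∀
  minus-one : ∀ d → - d ≡ 1ℤ - d - 1ℤ
  minus-one = solve-∀
  cancel : ∀ x y → -1ℤ * y + (x + y) ≡ x
  cancel = solve-∀

sumβ-coeff : ∀ F a α → sumβ F a α ≡ ∑[ k ≤ a ] F k a α
sumβ-coeff F a α = Σℤ-map-range0 a (λ k → F k a α)

IsβFree : PS → Set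
IsβFree H = ∀ a α → H (suc a) α ≡ 0ℤ

hPoly-βFree : ∀ m q p → IsβFree (hPoly m q p)
hPoly-βFree (+ d) q p a α = refl
hPoly-βFree -[1+ d ] q p a α = refl

βFree-∸ : ∀ {H} → IsβFree H → ∀ {a k} α → k < a → H (a ∸ k) α ≡ 0ℤ
βFree-∸ {H} H-βFree α k<a = trans (cong (λ n → H n α) (m>n⇒m∸n≡1+[m∸1+n] k<a)) (H-βFree _ α)

*ₚ-βFreeʳ : ∀ {H} → IsβFree H → ∀ F a α → (F *ₚ H) a α ≡ ∑[ x · y ≔ α ] F a x * H 0 y
*ₚ-βFreeʳ {H} H-βFree F a α =
  trans (*ₚ-coeff F H a α)
  (trans (∑≤-single a a ℕₚ.≤-refl (λ k k≤a k≢a → ∑split-zero α (λ x y →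
            trans (cong (F k x *_) (βFree-∸ {H} H-βFree y (ℕₚ.≤∧≢⇒< k≤a k≢a))) (ℤₚ.*-zeroʳ (F k x)))))
         (∑split-cong α (λ x y → cong (λ n → F a x * H n y) (ℕₚ.n∸n≡0 a))))

*ₚ-βmonomial-coeff : ∀ Q c s → Q ≈ₚ βmonomial c s → ∀ H {a} α → s ≤ a → (Q *ₚ H) a α ≡ c * H (a ∸ s) α
*ₚ-βmonomial-coeff Q c s Q≈cβˢ H {a} α s≤a =
  trans (*ₚ-cong Q≈cβˢ (λ _ _ → refl) a α) (βmonomial-*ₚ c s H a α s≤a)

G-coeff : ∀ q p m a α →
  G p (suc q) m a α ≡ ∑[ k ≤ a ] -1ℤ ^ k * (Cfac p (suc q) *ₚ hPoly (m + + k) (suc q) p) (a ∸ k) α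
G-coeff q p m a α =
  trans (sumβ-coeff (λ k → powₚ (scale -1ℤ βₚ) k *ₚ coefU (Bᵤ (suc q) p) (m + + k)) a α)
        (∑≤-cong-≤ a (λ k k≤a →
          trans (*ₚ-βmonomial-coeff (powₚ (scale -1ℤ βₚ) k) (-1ℤ ^ k) k (powₚ-βmonomial -1ℤ (λ _ _ → refl) k)
                                    (coefU (Bᵤ (suc q) p) (m + + k)) α k≤a)
                (cong (-1ℤ ^ k *_) (coefU-Bᵤ q p (m + + k) (a ∸ k) α))))

hPleth-coeff : ∀ M q p c a α → hPleth M q p c a α ≡ onePlusYNeg c a * hPoly (M + + a) q p 0 α
hPleth-coeff M q p c a α =
  trans (sumβ-coeff (λ b → hPoly (M + + b) q p *ₚ hBeta c b) a α)
  (trans (∑≤-cong-≤ a (λ b b≤a →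
            trans (*ₚ-comm (hPoly (M + + b) q p) (hBeta c b) a α)
                  (*ₚ-βmonomial-coeff (hBeta c b) (onePlusYNeg c b) b (scale-powₚ-βₚ (onePlusYNeg c b) b) (hPoly (M + + b) q p) α b≤a)))
  (trans (∑≤-single a a ℕₚ.≤-refl (λ b b≤a b≢a →
            trans (cong (onePlusYNeg c b *_) (βFree-∸ {hPoly (M + + b) q p} (hPoly-βFree (M + + b) q p) α (ℕₚ.≤∧≢⇒< b≤a b≢a)))
                  (ℤₚ.*-zeroʳ (onePlusYNeg c b))))
         (cong (λ n → onePlusYNeg c a * hPoly (M + + a) q p n α) (ℕₚ.n∸n≡0 a))))

binomial-G-expansion : ∀ q p M d a α →
  sumβ (λ s → scale (binomℤ d s) (powₚ βₚ s) *ₚ G p (suc q) (M + + s)) a α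
  ≡ ∑[ N ≤ a ] onePlusYNeg (1ℤ - d) N * (Cfac p (suc q) *ₚ hPoly (M + + N) (suc q) p) (a ∸ N) α
binomial-G-expansion q p M d a α =
  begin
    sumβ (λ s → scale (binomℤ d s) (powₚ βₚ s) *ₚ G p (suc q) (M + + s)) a α
  ≡⟨ sumβ-coeff (λ s → scale (binomℤ d s) (powₚ βₚ s) *ₚ G p (suc q) (M + + s)) a α ⟩
    ∑[ s ≤ a ] (scale (binomℤ d s) (powₚ βₚ s) *ₚ G p (suc q) (M + + s)) a α
  ≡⟨ ∑≤-cong-≤ a (λ s s≤a → *ₚ-βmonomial-coeff (scale (binomℤ d s) (powₚ βₚ s)) (binomℤ d s) s (scale-powₚ-βₚ (binomℤ d s) s) (G p (suc q) (M + + s)) α s≤a) ⟩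
    ∑[ s ≤ a ] binomℤ d s * G p (suc q) (M + + s) (a ∸ s) α
  ≡⟨ ∑≤-cong a (λ s → trans (cong (binomℤ d s *_) (expandG s)) (*-distribˡ-∑≤ (a ∸ s) (binomℤ d s) _)) ⟩
    ∑[ s ≤ a ] ∑[ k ≤ a ∸ s ] binomℤ d s * (-1ℤ ^ k * W (s ℕ.+ k))
  ≡⟨ ∑≤-triangle a (λ j l _ → binomℤ d j * (-1ℤ ^ l * W (j ℕ.+ l))) ⟨
    ∑[ N ≤ a ] ∑[ j ≤ N ] binomℤ d j * (-1ℤ ^ (N ∸ j) * W (j ℕ.+ (N ∸ j)))
  ≡⟨ ∑≤-cong a (λ N → ∑≤-cong-≤ N (λ j j≤N →
       trans (cong (λ n → binomℤ d j * (-1ℤ ^ (N ∸ j) * W n)) (ℕₚ.m+[n∸m]≡n j≤N))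
             (sym (ℤₚ.*-assoc (binomℤ d j) _ (W N))))) ⟩
    ∑[ N ≤ a ] ∑[ j ≤ N ] binomℤ d j * -1ℤ ^ (N ∸ j) * W N
  ≡⟨ ∑≤-cong a (λ N → trans (sym (*-distribʳ-∑≤ N (W N) _)) (cong (_* W N) (∑binom-alternating d N))) ⟩
    ∑[ N ≤ a ] onePlusYNeg (1ℤ - d) N * W N
  ∎
  where
  open ≡-Reasoning
  W : ℕ → ℤ
  W N = (Cfac p (suc q) *ₚ hPoly (M + + N) (suc q) p) (a ∸ N) α
  expandG : ∀ s → G p (suc q) (M + + s) (a ∸ s) α ≡ ∑[ k ≤ a ∸ s ] -1ℤ ^ k * W (s ℕ.+ k)
  expandG s =
    trans (G-coeff q p (M + + s) (a ∸ s) α)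
          (∑≤-cong (a ∸ s) (λ k → cong₂ (λ m n → -1ℤ ^ k * (Cfac p (suc q) *ₚ hPoly m (suc q) p) n α)
                                        (trans (ℤₚ.+-assoc M (+ s) (+ k)) (cong (_+_ M) (sym (ℤₚ.pos-+ s k))))
                                        (ℕₚ.∸-+-assoc a s k)))

Cfac-hPleth-expansion : ∀ q p M c a α →
  (Cfac p q *ₚ hPleth M q p c) a α
  ≡ ∑[ N ≤ a ] onePlusYNeg c N * (Cfac p q *ₚ hPoly (M + + N) q p) (a ∸ N) α
Cfac-hPleth-expansion q p M c a α =
  begin
    (C *ₚ hPleth M q p c) a α
  ≡⟨ *ₚ-coeff C _ a α ⟩
    ∑[ k ≤ a ] ∑[ x · y ≔ α ] C k x * hPleth M q p c (a ∸ k) y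
  ≡⟨ ∑≤-cong a (λ k → ∑split-cong α (λ x y →
       trans (cong (C k x *_) (hPleth-coeff M q p c (a ∸ k) y)) (ℤₚ.*-comm (C k x) _))) ⟩
    ∑[ k ≤ a ] ∑[ x · y ≔ α ] onePlusYNeg c (a ∸ k) * hPoly (M + + (a ∸ k)) q p 0 y * C k x
  ≡⟨ ∑≤-cong a (λ k → ∑split-cong α (λ x y → scalarFirst (onePlusYNeg c (a ∸ k)) _ (C k x))) ⟩
    ∑[ k ≤ a ] ∑[ x · y ≔ α ] onePlusYNeg c (a ∸ k) * (C k x * hPoly (M + + (a ∸ k)) q p 0 y)
  ≡⟨ ∑≤-cong a (λ k → *-distribˡ-∑split α (onePlusYNeg c (a ∸ k)) _) ⟨
    ∑[ k ≤ a ] onePlusYNeg c (a ∸ k) * (∑[ x · y ≔ α ] C k x * hPoly (M + + (a ∸ k)) q p 0 y)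
  ≡⟨ ∑≤-reverse a (λ k N → onePlusYNeg c N * (∑[ x · y ≔ α ] C k x * hPoly (M + + N) q p 0 y)) ⟩
    ∑[ N ≤ a ] onePlusYNeg c N * (∑[ x · y ≔ α ] C (a ∸ N) x * hPoly (M + + N) q p 0 y)
  ≡⟨ ∑≤-cong a (λ N → cong (onePlusYNeg c N *_) (*ₚ-βFreeʳ {hPoly (M + + N) q p} (hPoly-βFree (M + + N) q p) C (a ∸ N) α)) ⟨
    ∑[ N ≤ a ] onePlusYNeg c N * (C *ₚ hPoly (M + + N) q p) (a ∸ N) α
  ∎
  where
  open ≡-Reasoning
  C = Cfac p q
  scalarFirst : ∀ e h c → e * h * c ≡ e * (c * h)
  scalarFirst = solve-∀

binomial-G-identity : ∀ q p M d → 1 ≤ q →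
  sumβ (λ s → scale (binomℤ d s) (powₚ βₚ s) *ₚ G p q (M + + s))
  ≈ₚ (Cfac p q *ₚ hPleth M q p (1ℤ - d))
binomial-G-identity (suc q) p M d _ a α =
  trans (binomial-G-expansion q p M d a α) (sym (Cfac-hPleth-expansion (suc q) p M (1ℤ - d) a α))

lemma3p27 : (n : ℕ) (la mu : Vec ℕ n) → IsPartition la → IsPartition mu →
    (f g : Vec ℕ n) → (∀ k → 1 ≤ lookup f k) → (∀ k → 1 ≤ lookup g k) →
    (i j : Fin n) →
    sumβ (λ s → scale (binomℤ (+ suc (toℕ i) - + suc (toℕ j)) s) (powₚ βₚ s)
                *ₚ G (lookup f i) (lookup g j)
                     (+ lookup la i - + lookup mu j - + suc (toℕ i) + + suc (toℕ j) + + s))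
    ≈ₚ (Cfac (lookup f i) (lookup g j)
        *ₚ hPleth (+ lookup la i - + lookup mu j - + suc (toℕ i) + + suc (toℕ j))
                  (lookup g j) (lookup f i)
                  (+ suc (toℕ j) - + suc (toℕ i) + + 1))
lemma3p27 n la mu _ _ f g _ g≥1 i j a α =
  trans (binomial-G-identity (lookup g j) (lookup f i) M (i₁ - j₁) (g≥1 j) a α)
        (cong (λ c → (Cfac (lookup f i) (lookup g j) *ₚ hPleth M (lookup g j) (lookup f i) c) a α)
              (exponent≡ i₁ j₁))
  where
  i₁ = + suc (toℕ i)
  j₁ = + suc (toℕ j)
  M = + lookup la i - + lookup mu j - i₁ + j₁
  exponent≡ : ∀ x y → 1ℤ - (x - y) ≡ y - x + 1ℤ
  exponent≡ = solve-∀
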